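{- For every $X\in\langle\widetilde{\mathrm{Ims}}^\infty\cup\widetilde{\mathrm{LIm}}\rangle$, $o(\mathrm{Moon}+X)=\mathcal N$.
   Context: Games. Two players, Left and Right, alternate; a position $G$ is determined by its set $G^{\mathcal L}$ of Left options and $G^{\mathcal R}$ of Right options, written $G\cong\{G^{\mathcal L}\mid G^{\mathcal R}\}$. The disjunctive sum is $G+H\cong\{G^{\mathcal L}+H,\,G+H^{\mathcal L}\mid G^{\mathcal R}+H,\,G+H^{\mathcal R}\}$. Normal play: a player with no move loses. The outcome $o(G)$ is $\mathcal N$ if the player to move can force a win, $\mathcal P$ if the other player can, $\mathcal L$ (resp. $\mathcal R$) if Left (resp. Right) can force a win whoever starts, and $\mathcal D$ (draw) if under optimal play neither player can force a win (play continues forever). Nimbers: $*0=0\cong\{\,\mid\,\}$, $*n\cong\{*0,\dots,*(n-1)\mid *0,\dots,*(n-1)\}$. Impartial loopy games: $\widetilde{\mathrm{LIm}}$ is the set of positions of impartial rulesets (Left and Right options coincide) in which play need not terminate. Impartial entailing games: positions (short) built recursively from $\infty$ and $\overline\infty$, immediate wins for Left and Right respectively ($o(\infty)=\mathcal L$, $o(\overline\infty)=\mathcal R$, $\infty+X=\infty$ for $X\neq\overline\infty$, $\overline\infty+X=\overline\infty$ for $X\neq\infty$). Conjugate: $\infty,\overline\infty$ conjugate to each other, otherwise $\overline G=\{\overline{G^{\mathcal R}}\mid\overline{G^{\mathcal L}}\}$. $G$ is symmetric if $G\notin\{\infty,\overline\infty\}$ and $G^{\mathcal R}=\overline{G^{\mathcal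 L}}$; quiet if $G\notin\{\infty,\overline\infty\}$, $\infty\notin G^{\mathcal L}$, $\overline\infty\notin G^{\mathcal R}$. $\widetilde{\mathrm{Im}}^\infty$ = symmetric positions all of whose quiet followers are symmetric; $G=_{\widetilde{\mathrm{Im}}^\infty}H$ iff $o(G+X)=o(H+X)$ for all $X\in\widetilde{\mathrm{Im}}^\infty$. $\mathrm{Moon}\cong\{\infty\mid\overline\infty\}$. Special moon: $\mathrm{SMoon}(n)_A\cong\{\{\infty\mid *n\},A\mid A,\{*n\mid\overline\infty\}\}$, $A$ a set of nimbers and previously constructed special moons with $*n\in A$. $\widetilde{\mathrm{Ims}}^\infty$ is the set of $G\in\widetilde{\mathrm{Im}}^\infty$ with $G=_{\widetilde{\mathrm{Im}}^\infty}*k$ for some $k$, or $G\cong\mathrm{Moon}$, or $G\cong\mathrm{SMoon}(n)_A$ for some $n,A$. $\langle\widetilde{\mathrm{Ims}}^\infty\cup\widetilde{\mathrm{LIm}}\rangle$ is the set of finite sums $G_1+\dots+G_r+H_1+\dots+H_s$ with $G_i\in\widetilde{\mathrm{Ims}}^\infty$, $H_j\in\widetilde{\mathrm{LIm}}$. By convention (definition), $o(\infty+X)=\mathcal L$ and $o(\overline\infty+X)=\mathcal R$ for every $X$ in this set. -}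

module Defs where

open import Data.Nat using (ℕ; zero; suc)
open import Data.List using (List; []; _∷_; _++_; [_])
open import Data.List.Relation.Unary.All using (All)
open import Data.List.Relation.Unary.Any using (Any)
open import Data.List.Membership.Propositional using (_∈_)
open import Data.Product using (_×_; _,_; proj₁; proj₂; ∃; ∃-syntax)
open import Data.Sum using (_⊎_)
open import Relation.Binary.PropositionalEquality using (_≡_)
open import Relation.Nullary using (¬_)

data Player : Set where
  Left Right : Player

opp : Player → Player
opp Left  = Right
opp Right = Left

-- Short (entailing) game forms.  Option sets are represented by lists;
-- identity of forms "≅" below compares option lists as sets.

data EGame : Set where
  ∞  : EGame                                -- immediate win for Left
  ∞̄  : EGame                                -- immediate win for Right
  ⟨_∣_⟩ : List EGame → List EGame → EGame

opts : Player → EGame → List EGame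
opts _     ∞         = []
opts _     ∞̄         = []
opts Left  ⟨ L ∣ R ⟩ = L
opts Right ⟨ L ∣ R ⟩ = R

target : Player → EGame
target Left  = ∞
target Right = ∞̄

data _≅_ : EGame → EGame → Set where
  ∞≅  : ∞ ≅ ∞
  ∞̄≅  : ∞̄ ≅ ∞̄
  node≅ : ∀ {a b c d} →
          All (λ x → Any (λ y → x ≅ y) c) a → All (λ y → Any (λ x → x ≅ y) a) c →
          All (λ x → Any (λ y → x ≅ y) d) b → All (λ y → Any (λ x → x ≅ y) b) d →
          ⟨ a ∣ b ⟩ ≅ ⟨ c ∣ d ⟩

_≅ₛ_ : List EGame → List EGame → Set
xs ≅ₛ ys = All (λ x → Any (λ y → x ≅ y) ys) xs × All (λ y → Any (λ x → x ≅ y) xs) ys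

mutual
  conj : EGame → EGame
  conj ∞         = ∞̄
  conj ∞̄         = ∞
  conj ⟨ L ∣ R ⟩ = ⟨ conjs R ∣ conjs L ⟩

  conjs : List EGame → List EGame
  conjs []       = []
  conjs (g ∷ gs) = conj g ∷ conjs gs

Symmetric : EGame → Set
Symmetric ∞         = ⊥'
  where open import Data.Empty renaming (⊥ to ⊥')
Symmetric ∞̄         = ⊥'
  where open import Data.Empty renaming (⊥ to ⊥')
Symmetric ⟨ L ∣ R ⟩ = R ≅ₛ conjs L

Quiet : EGame → Set
Quiet ∞         = ⊥'
  where open import Data.Empty renaming (⊥ to ⊥')
Quiet ∞̄         = ⊥'
  where open import Data.Empty renaming (⊥ to ⊥')
Quiet ⟨ L ∣ R ⟩ = ¬ (∞ ∈ L) × ¬ (∞̄ ∈ R)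

data Follower : EGame → EGame → Set where
  self  : ∀ {G} → Follower G G
  step  : ∀ {H G' G} p → G' ∈ opts p G → Follower H G' → Follower H G

ImInf : EGame → Set
ImInf G = Symmetric G × (∀ H → Follower H G → Quiet H → Symmetric H)

-- Impartial loopy games: an arbitrary game graph (same moves for both
-- players) together with a current position.

record LArena : Set₁ where
  field
    Pos : Set
    mv  : Pos → Pos → Set      -- mv p q : q is an option of p

record LPos : Set₁ where
  constructor _at_
  field
    arena : LArena
    pos   : LArena.Pos arena

-- Sums: a position of G₁ + … + G_r + H₁ + … + H_s is a list of entailing
-- forms together with a list of loopy positions; a move is a move in
-- exactly one component.

SumPos : Set₁
SumPos = List EGame × List LPos

data EStep (p : Player) : List EGame → List EGame → Set where
  here  : ∀ {g g' gs} → g' ∈ opts p g → EStep p (g ∷ gs) (g' ∷ gs)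
  there : ∀ {g gs gs'} → EStep p gs gs' → EStep p (g ∷ gs) (g ∷ gs')

data LStep : List LPos → List LPos → Set₁ where
  here  : ∀ {A x y hs} → LArena.mv A x y → LStep ((A at x) ∷ hs) ((A at y) ∷ hs)
  there : ∀ {h hs hs'} → LStep hs hs' → LStep (h ∷ hs) (h ∷ hs')

data Move (p : Player) : SumPos → SumPos → Set₁ where
  emove : ∀ {gs gs' hs} → EStep p gs gs' → Move p (gs , hs) (gs' , hs)
  lmove : ∀ {gs hs hs'} → LStep hs hs' → Move p (gs , hs) (gs , hs')

-- some entailing component is the immediate win ∞ (resp. ∞̄) of player p;
-- by convention o(∞ + X) = L and o(∞̄ + X) = R.
Entailed : Player → SumPos → Set
Entailed p s = Any (λ g → g ≡ target p) (proj₁ s)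

Live : SumPos → Set
Live s = ¬ Entailed Left s × ¬ Entailed Right s

-- Win w m s : player w can force a win (in finitely many moves) from s
-- when player m is to move.  Normal play: a player unable to move loses.
data Win (w : Player) : Player → SumPos → Set₁ where
  entail : ∀ {m s} → Entailed w s → Win w m s
  choose : ∀ {s t} → Live s → Move w s t → Win w (opp w) t → Win w w s
  force  : ∀ {s} → Live s → (∀ t → Move (opp w) s t → Win w w t) → Win w (opp w) s

data Outcome : Set where
  𝓛 𝓡 𝓝 𝓟 𝓓 : Outcome

IsOutcome : SumPos → Outcome → Set₁
IsOutcome s 𝓛 = Win Left Left s × Win Left Right s
IsOutcome s 𝓡 = Win Right Left s × Win Right Right s
IsOutcome s 𝓝 = Win Left Left s × Win Right Right s
IsOutcome s 𝓟 = Win Right Left s × Win Left Right s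
IsOutcome s 𝓓 = ¬ (Win Left Left s × Win Left Right s) × ¬ (Win Right Left s × Win Right Right s)
              × ¬ (Win Left Left s × Win Right Right s) × ¬ (Win Right Left s × Win Left Right s)

_=Im_ : EGame → EGame → Set₁
G =Im H = ∀ X → ImInf X → ∀ out →
          (IsOutcome (G ∷ X ∷ [] , []) out → IsOutcome (H ∷ X ∷ [] , []) out) ×
          (IsOutcome (H ∷ X ∷ [] , []) out → IsOutcome (G ∷ X ∷ [] , []) out)

mutual
  nim : ℕ → EGame
  nim n = ⟨ nims n ∣ nims n ⟩

  nims : ℕ → List EGame
  nims zero    = []
  nims (suc n) = nims n ++ [ nim n ]

Moon : EGame
Moon = ⟨ [ ∞ ] ∣ [ ∞̄ ] ⟩

smoon : ℕ → List EGame → EGame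
smoon n A = ⟨ ⟨ [ ∞ ] ∣ [ nim n ] ⟩ ∷ A ∣ A ++ [ ⟨ [ nim n ] ∣ [ ∞̄ ] ⟩ ] ⟩

IsNimber : EGame → Set
IsNimber a = ∃[ k ] (a ≅ nim k)

data IsSMoon : EGame → Set where
  mk : ∀ {G} (n : ℕ) (A : List EGame) →
       All (λ a → IsNimber a ⊎ IsSMoon a) A →
       Any (λ a → a ≅ nim n) A →
       G ≅ smoon n A → IsSMoon G

InIms : EGame → Set₁
InIms G = ImInf G × ((∃[ k ] (G =Im nim k)) ⊎ (G ≅ Moon) ⊎ Lift₁ (IsSMoon G))
  where
  open import Level using () renaming (Lift to Lift')
  Lift₁ : Set → Set₁
  Lift₁ A = Lift' _ A

-- Whoever moves first plays Moon to their own immediate win.  That move is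
-- legal because the sum is not already decided: Moon and every component in
-- Ims~^∞ are symmetric, so none of them is ∞ or ∞̄.
module Submission where

open import Defs
open import Data.List using (List; _∷_; [])
open import Data.List.Relation.Unary.All as All using (All; _∷_; [])
open import Data.List.Relation.Unary.All.Properties using (All¬⇒¬Any)
open import Data.List.Relation.Unary.Any using (Any; here)
open import Data.List.Membership.Propositional using (_∈_)
open import Data.Product using (_,_; proj₁)
open import Function using (_∘_)
open import Relation.Binary.PropositionalEquality using (_≡_; _≢_; refl)
open import Relation.Nullary using (¬_)

symmetric⇒≢target : ∀ p {G} → Symmetric G → G ≢ target p
symmetric⇒≢target Left  {∞}  () refl
symmetric⇒≢target Right {∞̄} () refl

all-symmetric⇒¬entailed : ∀ p {gs} → All Symmetric gs → ¬ Any (_≡ target p) gs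
all-symmetric⇒¬entailed p = All¬⇒¬Any ∘ All.map (symmetric⇒≢target p)

all-symmetric⇒live : ∀ {gs} hs → All Symmetric gs → Live (gs , hs)
all-symmetric⇒live hs sym = all-symmetric⇒¬entailed Left sym , all-symmetric⇒¬entailed Right sym

moon-symmetric : Symmetric Moon
moon-symmetric = here ∞̄≅ ∷ [] , here ∞̄≅ ∷ []

target∈moon-options : ∀ p → target p ∈ opts p Moon
target∈moon-options Left  = here refl
target∈moon-options Right = here refl

moon-wins-moving-first : ∀ p {gs hs} → Live (Moon ∷ gs , hs) → Win p p (Moon ∷ gs , hs)
moon-wins-moving-first p live =
  choose live (emove (here (target∈moon-options p))) (entail (here refl))

mainTheorem2 : (gs : List EGame) (hs : List LPos) → All InIms gs → IsOutcome (Moon ∷ gs , hs) 𝓝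
mainTheorem2 gs hs ims = moon-wins-moving-first Left live , moon-wins-moving-first Right live
  where
  live : Live (Moon ∷ gs , hs)
  live = all-symmetric⇒live hs (moon-symmetric ∷ All.map (proj₁ ∘ proj₁) ims)
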